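{- Let $s,t\ge 3$ be integers and let $X(s,t)$ be the graph defined in the context. Then the derivative of the chromatic polynomial of $X(s,t)$ evaluated at $x=2$ is $$P'(X(s,t),2)=2\left((-1)^s+(-1)^t+(-1)^{s+t}\right).$$ In particular, when $s$ and $t$ are both odd, $P'(X(s,t),2)=-2$.
   Context: For a finite graph $G$, the chromatic polynomial $P(G,x)$ is the unique polynomial such that for every natural number $k$, $P(G,k)$ is the number of proper colourings of $G$ with at most $k$ colours; $P'(G,x)$ denotes its derivative in $x$. For integers $s,t\ge 3$, the graph $X(s,t)$ has vertex set $\{v_0,v_1,v_2,v_3,v_4\}\cup S\cup T$, where $S$ is a set of $s$ vertices and $T$ is a set of $t$ vertices (all these sets pairwise disjoint), and edge set consisting of: the edge $v_1v_2$; the edge $v_3v_4$; all edges $v_1u$, $v_3u$ and $v_0u$ for $u\in S$; and all edges $v_2w$, $v_4w$ and $v_0w$ for $w\in T$. There are no other edges. -}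

module Defs where

open import Data.Bool using (Bool; true; false; _∧_; _∨_; not; if_then_else_)
open import Data.Nat as ℕ using (ℕ; zero; suc; _≡ᵇ_)
open import Data.Fin using (Fin; toℕ)
open import Data.Fin.Properties using (_≟_)
open import Data.List using (List; []; _∷_; map; concatMap; filter; length; foldr)
open import Data.List.Base using (allFin)
open import Data.Product using (_×_; _,_)
open import Data.Integer as ℤ using (ℤ; +_)
open import Relation.Nullary.Decidable using (⌊_⌋)

record Graph : Set where
  field
    order : ℕ
    adj   : Fin order → Fin order → Bool
open Graph public

open import Data.Vec using (Vec; []; _∷_; lookup)

allColourings : (n k : ℕ) → List (Vec (Fin k) n)
allColourings zero    k = [] ∷ []
allColourings (suc n) k =
  concatMap (λ c → map (c ∷_) (allColourings n k)) (allFin k)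

allB : {A : Set} → (A → Bool) → List A → Bool
allB p = foldr (λ a b → p a ∧ b) true

isProper : (G : Graph) {k : ℕ} → Vec (Fin k) (order G) → Bool
isProper G c =
  allB (λ i → allB (λ j → not (adj G i j) ∨ not ⌊ lookup c i ≟ lookup c j ⌋)
                 (allFin (order G)))
      (allFin (order G))

numColourings : Graph → ℕ → ℕ
numColourings G k =
  length (filter (λ c → isProper G c Data.Bool.≟ true) (allColourings (order G) k))

-- Polynomials with integer coefficients: coefficient lists,
-- constant term first.

Poly : Set
Poly = List ℤ

eval : Poly → ℤ → ℤ
eval []       x = + 0
eval (a ∷ as) x = a ℤ.+ x ℤ.* eval as x

derivFrom : ℕ → Poly → Poly
derivFrom i []       = []
derivFrom i (a ∷ as) = (+ i) ℤ.* a ∷ derivFrom (suc i) as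

deriv : Poly → Poly
deriv []       = []
deriv (a ∷ as) = derivFrom 1 as

IsChromaticPolynomial : Graph → Poly → Set
IsChromaticPolynomial G p = ∀ (k : ℕ) → eval p (+ k) Relation.Binary.PropositionalEquality.≡ + numColourings G k
  where import Relation.Binary.PropositionalEquality

-- The graph X(s,t).  Vertex numbering (as naturals):
--   v₀,…,v₄  ↦ 0,…,4
--   S        ↦ 5, …, 4+s
--   T        ↦ 5+s, …, 4+s+t

inS : ℕ → ℕ → Bool
inS s u = ⌊ 5 ℕ.≤? u ⌋ ∧ ⌊ u ℕ.<? 5 ℕ.+ s ⌋

inT : ℕ → ℕ → ℕ → Bool
inT s t w = ⌊ 5 ℕ.+ s ℕ.≤? w ⌋ ∧ ⌊ w ℕ.<? 5 ℕ.+ s ℕ.+ t ⌋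

edgeX : ℕ → ℕ → ℕ → ℕ → Bool
edgeX s t a b =
     ((a ≡ᵇ 1) ∧ (b ≡ᵇ 2))                                   -- v₁v₂
  ∨ ((a ≡ᵇ 3) ∧ (b ≡ᵇ 4))                                    -- v₃v₄
  ∨ (((a ≡ᵇ 1) ∨ (a ≡ᵇ 3) ∨ (a ≡ᵇ 0)) ∧ inS s b)            -- v₁u, v₃u, v₀u (u ∈ S)
  ∨ (((a ≡ᵇ 2) ∨ (a ≡ᵇ 4) ∨ (a ≡ᵇ 0)) ∧ inT s t b)          -- v₂w, v₄w, v₀w (w ∈ T)

X : ℕ → ℕ → Graph
X s t = record
  { order = 5 ℕ.+ s ℕ.+ t
  ; adj   = λ i j → edgeX s t (toℕ i) (toℕ j) ∨ edgeX s t (toℕ j) (toℕ i)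
  }

-- Once v₀, …, v₄ are coloured, a vertex of S may take any colour avoiding those of v₀, v₁, v₃ and a
-- vertex of T any colour avoiding those of v₀, v₂, v₄.  The number of proper k-colourings is therefore
-- a five-fold sum over colours c₀, …, c₄ of [c₁ ≠ c₂] [c₃ ≠ c₄] (k - |{c₀,c₁,c₃}|)ˢ (k - |{c₀,c₂,c₄}|)ᵗ.
-- Evaluating the sums innermost first, each time splitting according to which of the colours already
-- chosen coincide, turns it into a fixed polynomial expression in k and the powers (k - i)ˢ, (k - i)ᵗ
-- (i = 1, 2, 3).  Substituting the polynomials x, (x - i)ˢ, (x - i)ᵗ gives a chromatic polynomial; any
-- other one agrees with it on ℕ and so has the same derivative.  Differentiating the expression by the
-- Leibniz rule and putting x = 2, where (x - 2)ˢ and (x - 2)ᵗ vanish together with their derivatives,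
-- leaves 2((-1)ˢ + (-1)ᵗ + (-1)ˢ⁺ᵗ).

module Submission where

open import Data.Bool as Bool using (Bool; true; false; T; not; _∧_; _∨_)
open import Data.Bool.Properties using (T-∧; T-∨)
open import Data.Empty using (⊥-elim)
open import Data.Fin using (Fin; zero; suc; toℕ; fromℕ<; reduce≥; #_; _↑ˡ_; _↑ʳ_)
open import Data.Fin.Properties using (_≟_; toℕ-↑ˡ; toℕ-↑ʳ; toℕ<n; toℕ-injective)
open import Data.Integer using (ℤ; +_; -_; _+_; _*_; _-_; _^_)
import Data.Integer.Properties as ℤP
open import Data.Integer.Tactic.RingSolver using (solve-∀; ring)
open import Data.List as List using (List; []; _∷_; length; filter; concatMap; tabulate; allFin)
open import Data.List.Membership.Propositional using (_∈_)
open import Data.List.Relation.Binary.Pointwise using (Pointwise; []; _∷_)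
open import Data.List.Relation.Unary.All as All using (All; []; _∷_)
open import Data.List.Relation.Unary.All.Properties using (tabulate⁺; tabulate⁻)
open import Data.List.Relation.Unary.AllPairs using (AllPairs; []; _∷_)
open import Data.List.Relation.Unary.Any using (here; there)
open import Data.Nat as ℕ using (ℕ; zero; suc; _≤_; s≤s)
open import Data.Nat.DivMod using (m≡m%n+[m/n]*n)
import Data.Nat.Properties as ℕP
open import Data.Product using (Σ; _×_; _,_; proj₁; proj₂)
open import Data.Sum using (inj₁; inj₂)
open import Data.Unit using (tt)
open import Data.Vec as Vec using (Vec; []; _∷_; lookup; _++_)
import Data.Vec.Properties as VecP
open import Data.Vec.Functional using (updateAt)
open import Data.Vec.Functional.Properties using (updateAt-updates; updateAt-minimal)
open import Defs
open import Function using (_∘_; id; const; _⇔_; mk⇔; Equivalence)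
open Equivalence using (to; from)
open import Relation.Binary.PropositionalEquality
open import Relation.Nullary using (yes; no)
open import Relation.Nullary.Decidable using (⌊_⌋; toWitness; fromWitness)
import Tactic.RingSolver.NonReflective as NonReflective
open import Algebra.Properties.Semiring.Sum ℤP.+-*-semiring
  using (sum-syntax; sum-cong-≗; *-distribˡ-sum; *-distribʳ-sum)

-- Integer polynomials and their derivatives

infixl 6 _+ₚ_ _-ₚ_
infixr 7 _·ₚ_
infixl 7 _*ₚ_
infixr 8 _^ₚ_

_+ₚ_ : Poly → Poly → Poly
[]      +ₚ q       = q
(a ∷ p) +ₚ []      = a ∷ p
(a ∷ p) +ₚ (b ∷ q) = a + b ∷ p +ₚ q

_·ₚ_ : ℤ → Poly → Poly
c ·ₚ p = List.map (c *_) p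

_-ₚ_ : Poly → Poly → Poly
p -ₚ q = p +ₚ (- + 1) ·ₚ q

_*ₚ_ : Poly → Poly → Poly
[]      *ₚ q = []
(a ∷ p) *ₚ q = a ·ₚ q +ₚ (+ 0 ∷ p *ₚ q)

_^ₚ_ : Poly → ℕ → Poly
p ^ₚ zero  = + 1 ∷ []
p ^ₚ suc n = p *ₚ p ^ₚ n

linearFactor : ℤ → Poly
linearFactor a = - a ∷ + 1 ∷ []

eval-+ₚ : ∀ p q x → eval (p +ₚ q) x ≡ eval p x + eval q x
eval-+ₚ []      q       x = sym (ℤP.+-identityˡ _)
eval-+ₚ (a ∷ p) []      x = sym (ℤP.+-identityʳ _)
eval-+ₚ (a ∷ p) (b ∷ q) x rewrite eval-+ₚ p q x = shuffle a b x (eval p x) (eval q x)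
  where
  shuffle : ∀ a b x P Q → a + b + x * (P + Q) ≡ a + x * P + (b + x * Q)
  shuffle = solve-∀

eval-·ₚ : ∀ c p x → eval (c ·ₚ p) x ≡ c * eval p x
eval-·ₚ c []      x = sym (ℤP.*-zeroʳ c)
eval-·ₚ c (a ∷ p) x rewrite eval-·ₚ c p x = distrib c a x (eval p x)
  where
  distrib : ∀ c a x P → c * a + x * (c * P) ≡ c * (a + x * P)
  distrib = solve-∀

eval-subtractₚ : ∀ p q x → eval (p -ₚ q) x ≡ eval p x - eval q x
eval-subtractₚ p q x = begin
  eval (p +ₚ (- + 1) ·ₚ q) x        ≡⟨ eval-+ₚ p ((- + 1) ·ₚ q) x ⟩
  eval p x + eval ((- + 1) ·ₚ q) x  ≡⟨ cong (λ y → eval p x + y) (eval-·ₚ (- + 1) q x) ⟩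
  eval p x + - + 1 * eval q x       ≡⟨ cong (λ y → eval p x + y) (ℤP.-1*i≡-i (eval q x)) ⟩
  eval p x - eval q x               ∎
  where open ≡-Reasoning

eval-*ₚ : ∀ p q x → eval (p *ₚ q) x ≡ eval p x * eval q x
eval-*ₚ []      q x = refl
eval-*ₚ (a ∷ p) q x
  rewrite eval-+ₚ (a ·ₚ q) (+ 0 ∷ p *ₚ q) x | eval-·ₚ a q x | eval-*ₚ p q x =
  distrib a x (eval p x) (eval q x)
  where
  distrib : ∀ a x P Q → a * Q + (+ 0 + x * (P * Q)) ≡ (a + x * P) * Q
  distrib = solve-∀

eval-constant : ∀ a x → eval (a ∷ []) x ≡ a
eval-constant a x = trans (cong (λ y → a + y) (ℤP.*-zeroʳ x)) (ℤP.+-identityʳ a)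

eval-^ₚ : ∀ p n x → eval (p ^ₚ n) x ≡ eval p x ^ n
eval-^ₚ p zero    x = eval-constant (+ 1) x
eval-^ₚ p (suc n) x rewrite eval-*ₚ p (p ^ₚ n) x | eval-^ₚ p n x = refl

eval-linearFactor : ∀ a x → eval (linearFactor a) x ≡ x - a
eval-linearFactor = normalise
  where
  normalise : ∀ a x → - a + x * (+ 1 + x * + 0) ≡ x - a
  normalise = solve-∀

eval′ : Poly → ℤ → ℤ
eval′ p = eval (deriv p)

eval-derivFrom-suc : ∀ i p x → eval (derivFrom (suc i) p) x ≡ eval (derivFrom i p) x + eval p x
eval-derivFrom-suc i []      x = refl
eval-derivFrom-suc i (a ∷ p) x rewrite eval-derivFrom-suc (suc i) p x =
  shuffle (+ i) a x (eval (derivFrom (suc i) p) x) (eval p x)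
  where
  shuffle : ∀ i a x E P → (+ 1 + i) * a + x * (E + P) ≡ i * a + x * E + (a + x * P)
  shuffle = solve-∀

eval-derivFrom-zero : ∀ p x → eval (derivFrom 0 p) x ≡ x * eval′ p x
eval-derivFrom-zero []      x = sym (ℤP.*-zeroʳ x)
eval-derivFrom-zero (a ∷ p) x = ℤP.+-identityˡ _

eval′-∷ : ∀ a p x → eval′ (a ∷ p) x ≡ eval p x + x * eval′ p x
eval′-∷ a p x rewrite eval-derivFrom-suc 0 p x | eval-derivFrom-zero p x =
  ℤP.+-comm (x * eval′ p x) (eval p x)

eval′-+ₚ : ∀ p q x → eval′ (p +ₚ q) x ≡ eval′ p x + eval′ q x
eval′-+ₚ []      q       x = sym (ℤP.+-identityˡ _)
eval′-+ₚ (a ∷ p) []      x = sym (ℤP.+-identityʳ _)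
eval′-+ₚ (a ∷ p) (b ∷ q) x
  rewrite eval′-∷ (a + b) (p +ₚ q) x | eval′-∷ a p x | eval′-∷ b q x
        | eval-+ₚ p q x | eval′-+ₚ p q x =
  shuffle x (eval p x) (eval q x) (eval′ p x) (eval′ q x)
  where
  shuffle : ∀ x P Q P′ Q′ → P + Q + x * (P′ + Q′) ≡ P + x * P′ + (Q + x * Q′)
  shuffle = solve-∀

eval′-·ₚ : ∀ c p x → eval′ (c ·ₚ p) x ≡ c * eval′ p x
eval′-·ₚ c []      x = sym (ℤP.*-zeroʳ c)
eval′-·ₚ c (a ∷ p) x
  rewrite eval′-∷ (c * a) (c ·ₚ p) x | eval′-∷ a p x | eval-·ₚ c p x | eval′-·ₚ c p x =
  distrib c x (eval p x) (eval′ p x)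
  where
  distrib : ∀ c x P P′ → c * P + x * (c * P′) ≡ c * (P + x * P′)
  distrib = solve-∀

eval′-subtractₚ : ∀ p q x → eval′ (p -ₚ q) x ≡ eval′ p x - eval′ q x
eval′-subtractₚ p q x = begin
  eval′ (p +ₚ (- + 1) ·ₚ q) x         ≡⟨ eval′-+ₚ p ((- + 1) ·ₚ q) x ⟩
  eval′ p x + eval′ ((- + 1) ·ₚ q) x  ≡⟨ cong (λ y → eval′ p x + y) (eval′-·ₚ (- + 1) q x) ⟩
  eval′ p x + - + 1 * eval′ q x       ≡⟨ cong (λ y → eval′ p x + y) (ℤP.-1*i≡-i (eval′ q x)) ⟩
  eval′ p x - eval′ q x               ∎
  where open ≡-Reasoning

eval′-*ₚ : ∀ p q x → eval′ (p *ₚ q) x ≡ eval′ p x * eval q x + eval p x * eval′ q x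
eval′-*ₚ []      q x = sym (ℤP.+-identityˡ (+ 0 * eval′ q x))
eval′-*ₚ (a ∷ p) q x
  rewrite eval′-+ₚ (a ·ₚ q) (+ 0 ∷ p *ₚ q) x | eval′-·ₚ a q x | eval′-∷ (+ 0) (p *ₚ q) x
        | eval-*ₚ p q x | eval′-*ₚ p q x | eval′-∷ a p x =
  distrib a x (eval p x) (eval q x) (eval′ p x) (eval′ q x)
  where
  distrib : ∀ a x P Q P′ Q′ →
    a * Q′ + (P * Q + x * (P′ * Q + P * Q′)) ≡ (P + x * P′) * Q + (a + x * P) * Q′
  distrib = solve-∀

eval′-^ₚ-doubleRoot : ∀ p n r → eval p r ≡ + 0 → eval′ (p ^ₚ suc (suc n)) r ≡ + 0
eval′-^ₚ-doubleRoot p n r root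
  rewrite eval′-*ₚ p (p ^ₚ suc n) r | eval-*ₚ p (p ^ₚ n) r | root =
  trans (ℤP.+-identityʳ (eval′ p r * + 0)) (ℤP.*-zeroʳ (eval′ p r))

-- Polynomials agreeing on ℕ have the same derivative

quotient : ℤ → Poly → Poly
quotient r []           = []
quotient r (a ∷ [])     = []
quotient r (a ∷ b ∷ bs) = eval (b ∷ bs) r ∷ quotient r (b ∷ bs)

eval-quotient : ∀ r p x → eval p x ≡ (x - r) * eval (quotient r p) x + eval p r
eval-quotient r []           x = sym (trans (ℤP.+-identityʳ _) (ℤP.*-zeroʳ (x - r)))
eval-quotient r (a ∷ [])     x = normalise r a x
  where
  normalise : ∀ r a x → a + x * + 0 ≡ (x - r) * + 0 + (a + r * + 0)
  normalise = solve-∀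
eval-quotient r (a ∷ b ∷ bs) x rewrite eval-quotient r (b ∷ bs) x =
  distrib r a x (eval (quotient r (b ∷ bs)) x) (eval (b ∷ bs) r)
  where
  distrib : ∀ r a x Q B → a + x * ((x - r) * Q + B) ≡ (x - r) * (B + x * Q) + (a + r * B)
  distrib = solve-∀

length-quotient : ∀ r a p → length (quotient r (a ∷ p)) ≡ length p
length-quotient r a []      = refl
length-quotient r a (b ∷ p) = cong suc (length-quotient r b p)

IsZero : Poly → Set
IsZero = All (_≡ + 0)

IsZero-quotient⇒IsZero : ∀ r p → eval p r ≡ + 0 → IsZero (quotient r p) → IsZero p
IsZero-quotient⇒IsZero r []           _    _              = []
IsZero-quotient⇒IsZero r (a ∷ [])     root _              = trans (sym (eval-constant a r)) root ∷ []
IsZero-quotient⇒IsZero r (a ∷ b ∷ bs) root (b∷bs[r]≡0 ∷ z) =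
  trans (sym a≡eval) root ∷ IsZero-quotient⇒IsZero r (b ∷ bs) b∷bs[r]≡0 z
  where
  a≡eval : eval (a ∷ b ∷ bs) r ≡ a
  a≡eval = trans (cong (λ y → a + r * y) b∷bs[r]≡0) (eval-constant a r)

-- Divide by x - m; the quotient vanishes at m + 1, m + 2, …
vanishingFrom⇒IsZero : ∀ n p → length p ≤ n → ∀ m → (∀ j → eval p (+ (m ℕ.+ j)) ≡ + 0) → IsZero p
vanishingFrom⇒IsZero n       []      _         m vanishes = []
vanishingFrom⇒IsZero (suc n) (a ∷ p) (s≤s |p|≤n) m vanishes =
  IsZero-quotient⇒IsZero (+ m) (a ∷ p) root
    (vanishingFrom⇒IsZero n q |q|≤n (suc m) q-vanishes)
  where
  q = quotient (+ m) (a ∷ p)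
  root : eval (a ∷ p) (+ m) ≡ + 0
  root = trans (cong (λ i → eval (a ∷ p) (+ i)) (sym (ℕP.+-identityʳ m))) (vanishes 0)
  |q|≤n : length q ≤ n
  |q|≤n rewrite length-quotient (+ m) a p = |p|≤n
  q-vanishes : ∀ j → eval q (+ (suc m ℕ.+ j)) ≡ + 0
  q-vanishes j = ℤP.*-cancelˡ-≡ (+ suc j) _ _ (begin
    + suc j * eval q y                          ≡⟨ cong (_* eval q y) (sym distance) ⟩
    (y - + m) * eval q y                        ≡⟨ sym (ℤP.+-identityʳ _) ⟩
    (y - + m) * eval q y + + 0                  ≡⟨ cong (λ z → (y - + m) * eval q y + z) (sym root) ⟩
    (y - + m) * eval q y + eval (a ∷ p) (+ m)   ≡⟨ sym (eval-quotient (+ m) (a ∷ p) y) ⟩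
    eval (a ∷ p) y                              ≡⟨ cong (λ i → eval (a ∷ p) (+ i)) (ℕP.+-suc m j) ⟨
    eval (a ∷ p) (+ (m ℕ.+ suc j))              ≡⟨ vanishes (suc j) ⟩
    + 0                                         ≡⟨ ℤP.*-zeroʳ (+ suc j) ⟨
    + suc j * + 0                               ∎)
    where
    open ≡-Reasoning
    y = + (suc m ℕ.+ j)
    distance : y - + m ≡ + suc j
    distance = begin
      y - + m                   ≡⟨ cong (_- + m) (ℤP.pos-+ 1 (m ℕ.+ j)) ⟩
      + 1 + + (m ℕ.+ j) - + m   ≡⟨ cong (λ z → + 1 + z - + m) (ℤP.pos-+ m j) ⟩
      + 1 + (+ m + + j) - + m   ≡⟨ cancel (+ m) (+ j) ⟩
      + 1 + + j                 ∎
      where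
      cancel : ∀ M J → + 1 + (M + J) - M ≡ + 1 + J
      cancel = solve-∀

eval-IsZero : ∀ p x → IsZero p → eval p x ≡ + 0
eval-IsZero []      x []           = refl
eval-IsZero (a ∷ p) x (refl ∷ z) rewrite eval-IsZero p x z =
  trans (ℤP.+-identityˡ _) (ℤP.*-zeroʳ x)

eval′-IsZero : ∀ p x → IsZero p → eval′ p x ≡ + 0
eval′-IsZero []      x []           = refl
eval′-IsZero (a ∷ p) x (refl ∷ z)
  rewrite eval′-∷ (+ 0) p x | eval-IsZero p x z | eval′-IsZero p x z =
  trans (ℤP.+-identityˡ _) (ℤP.*-zeroʳ x)

eval′-unique : ∀ p q → (∀ k → eval p (+ k) ≡ eval q (+ k)) → ∀ x → eval′ p x ≡ eval′ q x
eval′-unique p q p≗q x = ℤP.i-j≡0⇒i≡j _ _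
  (trans (sym (eval′-subtractₚ p q x)) (eval′-IsZero (p -ₚ q) x p-q≡0))
  where
  p-q≡0 : IsZero (p -ₚ q)
  p-q≡0 = vanishingFrom⇒IsZero _ (p -ₚ q) ℕP.≤-refl 0 λ j →
    trans (eval-subtractₚ p q (+ j)) (ℤP.i≡j⇒i-j≡0 (p≗q j))

-- Polynomial expressions in given polynomials

infixl 6 _⊕_
infixl 7 _⊗_

data Expr (n : ℕ) : Set where
  var     : Fin n → Expr n
  con     : ℤ → Expr n
  _⊕_ _⊗_ : Expr n → Expr n → Expr n

⟦_⟧ : ∀ {n} → Expr n → Vec ℤ n → ℤ
⟦ var i ⟧ ρ = lookup ρ i
⟦ con c ⟧ ρ = c
⟦ e ⊕ f ⟧ ρ = ⟦ e ⟧ ρ + ⟦ f ⟧ ρ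
⟦ e ⊗ f ⟧ ρ = ⟦ e ⟧ ρ * ⟦ f ⟧ ρ

toPoly : ∀ {n} → Vec Poly n → Expr n → Poly
toPoly ps (var i) = lookup ps i
toPoly ps (con c) = c ∷ []
toPoly ps (e ⊕ f) = toPoly ps e +ₚ toPoly ps f
toPoly ps (e ⊗ f) = toPoly ps e *ₚ toPoly ps f

values : ∀ {n} → Vec Poly n → ℤ → Vec ℤ n
values ps x = Vec.map (λ p → eval p x) ps

slopes : ∀ {n} → Vec Poly n → ℤ → Vec ℤ n
slopes ps x = Vec.map (λ p → eval′ p x) ps

eval-toPoly : ∀ {n} (ps : Vec Poly n) e x → eval (toPoly ps e) x ≡ ⟦ e ⟧ (values ps x)
eval-toPoly ps (var i) x = sym (VecP.lookup-map i (λ p → eval p x) ps)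
eval-toPoly ps (con c) x = eval-constant c x
eval-toPoly ps (e ⊕ f) x =
  trans (eval-+ₚ (toPoly ps e) (toPoly ps f) x) (cong₂ _+_ (eval-toPoly ps e x) (eval-toPoly ps f x))
eval-toPoly ps (e ⊗ f) x =
  trans (eval-*ₚ (toPoly ps e) (toPoly ps f) x) (cong₂ _*_ (eval-toPoly ps e x) (eval-toPoly ps f x))

weaken : ∀ {n} → Expr n → Expr (n ℕ.+ n)
weaken {n} (var i) = var (i ↑ˡ n)
weaken     (con c) = con c
weaken     (e ⊕ f) = weaken e ⊕ weaken f
weaken     (e ⊗ f) = weaken e ⊗ weaken f

-- In ∂ e, the variable n ↑ʳ i stands for the derivative of the variable i.
∂ : ∀ {n} → Expr n → Expr (n ℕ.+ n)
∂ {n} (var i) = var (n ↑ʳ i)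
∂     (con c) = con (+ 0)
∂     (e ⊕ f) = ∂ e ⊕ ∂ f
∂     (e ⊗ f) = ∂ e ⊗ weaken f ⊕ weaken e ⊗ ∂ f

⟦weaken⟧ : ∀ {n} (e : Expr n) ρ ρ′ → ⟦ weaken e ⟧ (ρ ++ ρ′) ≡ ⟦ e ⟧ ρ
⟦weaken⟧ (var i) ρ ρ′ = VecP.lookup-++ˡ ρ ρ′ i
⟦weaken⟧ (con c) ρ ρ′ = refl
⟦weaken⟧ (e ⊕ f) ρ ρ′ = cong₂ _+_ (⟦weaken⟧ e ρ ρ′) (⟦weaken⟧ f ρ ρ′)
⟦weaken⟧ (e ⊗ f) ρ ρ′ = cong₂ _*_ (⟦weaken⟧ e ρ ρ′) (⟦weaken⟧ f ρ ρ′)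

eval′-toPoly : ∀ {n} (ps : Vec Poly n) e x →
  eval′ (toPoly ps e) x ≡ ⟦ ∂ e ⟧ (values ps x ++ slopes ps x)
eval′-toPoly ps (var i) x =
  sym (trans (VecP.lookup-++ʳ (values ps x) _ i) (VecP.lookup-map i (λ p → eval′ p x) ps))
eval′-toPoly ps (con c) x = refl
eval′-toPoly ps (e ⊕ f) x =
  trans (eval′-+ₚ (toPoly ps e) (toPoly ps f) x) (cong₂ _+_ (eval′-toPoly ps e x) (eval′-toPoly ps f x))
eval′-toPoly ps (e ⊗ f) x = trans (eval′-*ₚ (toPoly ps e) (toPoly ps f) x)
  (cong₂ _+_ (cong₂ _*_ (eval′-toPoly ps e x) (value f)) (cong₂ _*_ (value e) (eval′-toPoly ps f x)))
  where
  value : ∀ g → eval (toPoly ps g) x ≡ ⟦ weaken g ⟧ (values ps x ++ slopes ps x)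
  value g = trans (eval-toPoly ps g x) (sym (⟦weaken⟧ g (values ps x) (slopes ps x)))

module Solver = NonReflective ring
module SolverOps = NonReflective.Ops ring

reify : ∀ {m n} → Vec (Solver.Expr ℤ m) n → Expr n → Solver.Expr ℤ m
reify σ (var i) = lookup σ i
reify σ (con c) = Solver.Κ c
reify σ (e ⊕ f) = reify σ e Solver.⊕ reify σ f
reify σ (e ⊗ f) = reify σ e Solver.⊗ reify σ f

⟦reify⟧ : ∀ {m n} (σ : Vec (Solver.Expr ℤ m) n) e ρ →
  SolverOps.⟦ reify σ e ⟧ ρ ≡ ⟦ e ⟧ (Vec.map (λ w → SolverOps.⟦ w ⟧ ρ) σ)
⟦reify⟧ σ (var i) ρ = sym (VecP.lookup-map i (λ w → SolverOps.⟦ w ⟧ ρ) σ)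
⟦reify⟧ σ (con c) ρ = refl
⟦reify⟧ σ (e ⊕ f) ρ = cong₂ _+_ (⟦reify⟧ σ e ρ) (⟦reify⟧ σ f ρ)
⟦reify⟧ σ (e ⊗ f) ρ = cong₂ _*_ (⟦reify⟧ σ e ρ) (⟦reify⟧ σ f ρ)

-- Counting colourings

𝟙 : Bool → ℤ
𝟙 true  = + 1
𝟙 false = + 0

𝟙-∧ : ∀ a b → 𝟙 (a ∧ b) ≡ 𝟙 a * 𝟙 b
𝟙-∧ true  b = sym (ℤP.*-identityˡ (𝟙 b))
𝟙-∧ false b = refl

count : {A : Set} → (A → Bool) → List A → ℤ
count f []       = + 0
count f (a ∷ xs) = 𝟙 (f a) + count f xs

length-filter : {A : Set} (f : A → Bool) (xs : List A) →
  + length (filter (λ a → f a Bool.≟ true) xs) ≡ count f xs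
length-filter f []       = refl
length-filter f (a ∷ xs) with f a
... | true  = cong (λ n → + 1 + n) (length-filter f xs)
... | false = trans (length-filter f xs) (sym (ℤP.+-identityˡ _))

count-cong : {A : Set} {f g : A → Bool} → (∀ a → f a ≡ g a) → ∀ xs → count f xs ≡ count g xs
count-cong f≗g []       = refl
count-cong f≗g (a ∷ xs) = cong₂ _+_ (cong 𝟙 (f≗g a)) (count-cong f≗g xs)

count-++ : {A : Set} (f : A → Bool) → ∀ xs ys → count f (xs List.++ ys) ≡ count f xs + count f ys
count-++ f []       ys = sym (ℤP.+-identityˡ _)
count-++ f (a ∷ xs) ys rewrite count-++ f xs ys = sym (ℤP.+-assoc (𝟙 (f a)) (count f xs) (count f ys))

count-map : {A B : Set} (f : B → Bool) (g : A → B) → ∀ xs → count f (List.map g xs) ≡ count (f ∘ g) xs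
count-map f g []       = refl
count-map f g (a ∷ xs) = cong (λ n → 𝟙 (f (g a)) + n) (count-map f g xs)

count-∧ : {A : Set} (b : Bool) (f : A → Bool) → ∀ xs → count (λ a → b ∧ f a) xs ≡ 𝟙 b * count f xs
count-∧ true  f xs       = sym (ℤP.*-identityˡ _)
count-∧ false f []       = refl
count-∧ false f (a ∷ xs) = trans (ℤP.+-identityˡ _) (count-∧ false f xs)

count-concatMap-tabulate : {A B : Set} (f : B → Bool) (g : A → List B) {k : ℕ} (h : Fin k → A) →
  count f (concatMap g (tabulate h)) ≡ ∑[ i < k ] count f (g (h i))
count-concatMap-tabulate f g {zero}  h = refl
count-concatMap-tabulate f g {suc k} h = trans (count-++ f (g (h zero)) _)
  (cong (λ n → count f (g (h zero)) + n) (count-concatMap-tabulate f g (h ∘ suc)))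

module _ {k : ℕ} where

  countColourings : (n : ℕ) → (Vec (Fin k) n → Bool) → ℤ
  countColourings n f = count f (allColourings n k)

  countColourings-cong : ∀ n {f g : Vec (Fin k) n → Bool} → (∀ c → f c ≡ g c) →
    countColourings n f ≡ countColourings n g
  countColourings-cong n f≗g = count-cong f≗g (allColourings n k)

  countColourings-suc : ∀ n (f : Vec (Fin k) (suc n) → Bool) →
    countColourings (suc n) f ≡ ∑[ c < k ] countColourings n (f ∘ (c ∷_))
  countColourings-suc n f =
    trans (count-concatMap-tabulate f (λ c → List.map (c ∷_) (allColourings n k)) id)
      (sum-cong-≗ (λ c → count-map f (c ∷_) (allColourings n k)))

  countColourings-++ : ∀ m n (f : Vec (Fin k) (m ℕ.+ n) → Bool) → ∀ g h →
    (∀ u v → f (u ++ v) ≡ g u ∧ h v) → countColourings (m ℕ.+ n) f ≡ countColourings m g * countColourings n h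
  countColourings-++ zero    n f g h f≡g∧h = begin
    countColourings n f                           ≡⟨ countColourings-cong n (f≡g∧h []) ⟩
    count (λ v → g [] ∧ h v) (allColourings n k)  ≡⟨ count-∧ (g []) h (allColourings n k) ⟩
    𝟙 (g []) * countColourings n h                ≡⟨ cong (_* countColourings n h) (ℤP.+-identityʳ (𝟙 (g []))) ⟨
    (𝟙 (g []) + + 0) * countColourings n h        ∎
    where open ≡-Reasoning
  countColourings-++ (suc m) n f g h f≡g∧h = begin
    countColourings (suc m ℕ.+ n) f
      ≡⟨ countColourings-suc (m ℕ.+ n) f ⟩
    ∑[ c < k ] countColourings (m ℕ.+ n) (f ∘ (c ∷_))
      ≡⟨ sum-cong-≗ (λ c → countColourings-++ m n _ (g ∘ (c ∷_)) h (f≡g∧h ∘ (c ∷_))) ⟩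
    ∑[ c < k ] (countColourings m (g ∘ (c ∷_)) * countColourings n h)
      ≡⟨ *-distribʳ-sum (countColourings n h) (λ c → countColourings m (g ∘ (c ∷_))) ⟨
    (∑[ c < k ] countColourings m (g ∘ (c ∷_))) * countColourings n h
      ≡⟨ cong (_* countColourings n h) (countColourings-suc m g) ⟨
    countColourings (suc m) g * countColourings n h ∎
    where open ≡-Reasoning

  countColourings-all : ∀ n (p : Fin k → Bool) →
    countColourings n (allB p ∘ Vec.toList) ≡ (∑[ d < k ] 𝟙 (p d)) ^ n
  countColourings-all zero    p = ℤP.+-identityʳ (+ 1)
  countColourings-all (suc n) p = begin
    countColourings (suc n) (allB p ∘ Vec.toList)
      ≡⟨ countColourings-suc n _ ⟩
    ∑[ d < k ] count (λ c → p d ∧ allB p (Vec.toList c)) (allColourings n k)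
      ≡⟨ sum-cong-≗ (λ d → count-∧ (p d) (allB p ∘ Vec.toList) (allColourings n k)) ⟩
    ∑[ d < k ] (𝟙 (p d) * countColourings n (allB p ∘ Vec.toList))
      ≡⟨ *-distribʳ-sum _ (λ d → 𝟙 (p d)) ⟨
    (∑[ d < k ] 𝟙 (p d)) * countColourings n (allB p ∘ Vec.toList)
      ≡⟨ cong (λ m → (∑[ d < k ] 𝟙 (p d)) * m) (countColourings-all n p) ⟩
    (∑[ d < k ] 𝟙 (p d)) ^ suc n ∎
    where open ≡-Reasoning

-- Proper colourings of X(s, t)

T-⇔⇒≡ : ∀ {a b} → T a ⇔ T b → a ≡ b
T-⇔⇒≡ {false} {false} _   = refl
T-⇔⇒≡ {false} {true}  a⇔b = ⊥-elim (from a⇔b tt)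
T-⇔⇒≡ {true}  {false} a⇔b = ⊥-elim (to a⇔b tt)
T-⇔⇒≡ {true}  {true}  _   = refl

T-not-∨ : ∀ {a b} → T (not a ∨ b) ⇔ (T a → T b)
T-not-∨ {false} = mk⇔ (λ _ ()) (λ _ → tt)
T-not-∨ {true}  = mk⇔ (λ b _ → b) (λ f → f tt)

T-allB : {A : Set} {p : A → Bool} {xs : List A} → T (allB p xs) ⇔ All (T ∘ p) xs
T-allB {xs = []}     = mk⇔ (λ _ → []) (λ _ → tt)
T-allB {xs = x ∷ xs} = mk⇔
  (λ px∧ → let (px , pxs) = to T-∧ px∧ in px ∷ to T-allB pxs)
  (λ { (px ∷ pxs) → from T-∧ (px , from T-allB pxs) })

T-allB-allFin : ∀ {n} {p : Fin n → Bool} → T (allB p (allFin n)) ⇔ (∀ i → T (p i))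
T-allB-allFin = mk⇔ (tabulate⁻ ∘ to T-allB) (from T-allB ∘ tabulate⁺)

T-allB-toList : ∀ {A : Set} {n} {p : A → Bool} {xs : Vec A n} →
  T (allB p (Vec.toList xs)) ⇔ (∀ i → T (p (lookup xs i)))
T-allB-toList {xs = []}     = mk⇔ (λ _ ()) (λ _ → tt)
T-allB-toList {p = p} {xs = x ∷ xs} = mk⇔
  (λ px∧ → let (px , pxs) = to T-∧ px∧ in λ { zero → px ; (suc i) → to rest pxs i })
  (λ p∀ → from T-∧ (p∀ zero , from rest (p∀ ∘ suc)))
  where
  rest = T-allB-toList {p = p} {xs = xs}

module _ {k : ℕ} where

  infix 7 _≠ᵇ_
  _≠ᵇ_ : Fin k → Fin k → Bool
  a ≠ᵇ b = not ⌊ a ≟ b ⌋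

  T-≠ᵇ : ∀ {a b} → T (a ≠ᵇ b) ⇔ a ≢ b
  T-≠ᵇ {a} {b} with a ≟ b
  ... | yes a≡b = mk⇔ (λ ()) (λ a≢b → a≢b a≡b)
  ... | no  a≢b = mk⇔ (λ _ → a≢b) (λ _ → tt)

  T-isProper : ∀ {G : Graph} {c : Vec (Fin k) (order G)} →
    T (isProper G c) ⇔ (∀ i j → T (adj G i j) → lookup c i ≢ lookup c j)
  T-isProper = mk⇔
    (λ proper i j e → to T-≠ᵇ (to T-not-∨ (to T-allB-allFin (to T-allB-allFin proper i) j) e))
    (λ distinct → from T-allB-allFin λ i → from T-allB-allFin λ j →
       from T-not-∨ (from T-≠ᵇ ∘ distinct i j))

  avoids : List (Fin k) → Fin k → Bool
  avoids cs d = allB (_≠ᵇ d) cs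

  T-avoids : ∀ {cs d} → T (avoids cs d) ⇔ All (_≢ d) cs
  T-avoids = mk⇔ (All.map (to T-≠ᵇ) ∘ to T-allB) (from T-allB ∘ All.map (from T-≠ᵇ))

T-inS : ∀ {s n} → T (inS s n) ⇔ (5 ≤ n × n ℕ.< 5 ℕ.+ s)
T-inS {s} {n} = mk⇔
  (λ p → let (p₁ , p₂) = to (T-∧ {⌊ 5 ℕ.≤? n ⌋}) p in toWitness p₁ , toWitness p₂)
  (λ (p₁ , p₂) → from (T-∧ {⌊ 5 ℕ.≤? n ⌋}) (fromWitness p₁ , fromWitness p₂))

T-inT : ∀ {s t n} → T (inT s t n) ⇔ (5 ℕ.+ s ≤ n × n ℕ.< 5 ℕ.+ s ℕ.+ t)
T-inT {s} {t} {n} = mk⇔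
  (λ p → let (p₁ , p₂) = to (T-∧ {⌊ 5 ℕ.+ s ℕ.≤? n ⌋}) p in toWitness p₁ , toWitness p₂)
  (λ (p₁ , p₂) → from (T-∧ {⌊ 5 ℕ.+ s ℕ.≤? n ⌋}) (fromWitness p₁ , fromWitness p₂))

module _ {k s t : ℕ} (c₀ c₁ c₂ c₃ c₄ : Fin k) (u : Vec (Fin k) s) (v : Vec (Fin k) t) where

  properX : Bool
  properX = ((c₁ ≠ᵇ c₂ ∧ c₃ ≠ᵇ c₄) ∧ allB (avoids (c₀ ∷ c₁ ∷ c₃ ∷ [])) (Vec.toList u))
            ∧ allB (avoids (c₀ ∷ c₂ ∷ c₄ ∷ [])) (Vec.toList v)

  ProperX : Set
  ProperX = c₁ ≢ c₂ × c₃ ≢ c₄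
          × (∀ i → All (_≢ lookup u i) (c₀ ∷ c₁ ∷ c₃ ∷ []))
          × (∀ j → All (_≢ lookup v j) (c₀ ∷ c₂ ∷ c₄ ∷ []))

  T-properX : T properX ⇔ ProperX
  T-properX = mk⇔
    (λ p → let (p₁₂₃ , pv) = to T-∧ p ; (p₁₂ , pu) = to T-∧ p₁₂₃ ; (p₁ , p₂) = to T-∧ p₁₂ in
      to T-≠ᵇ p₁ , to T-≠ᵇ p₂ ,
      to T-avoids ∘ to (T-allB-toList {xs = u}) pu , to T-avoids ∘ to (T-allB-toList {xs = v}) pv)
    (λ (c₁≢c₂ , c₃≢c₄ , avoidS , avoidT) → from T-∧
      (from T-∧ (from T-∧ (from T-≠ᵇ c₁≢c₂ , from T-≠ᵇ c₃≢c₄) ,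
                 from (T-allB-toList {xs = u}) (from T-avoids ∘ avoidS))
      , from (T-allB-toList {xs = v}) (from T-avoids ∘ avoidT)))

  private
    col : Vec (Fin k) (order (X s t))
    col = c₀ ∷ c₁ ∷ c₂ ∷ c₃ ∷ c₄ ∷ u ++ v

    sVertex : Fin s → Fin (order (X s t))
    sVertex i = suc (suc (suc (suc (suc (i ↑ˡ t)))))

    tVertex : Fin t → Fin (order (X s t))
    tVertex j = suc (suc (suc (suc (suc (s ↑ʳ j)))))

    sVertex∈S : ∀ i → T (inS s (toℕ (sVertex i)))
    sVertex∈S i = from T-inS (ℕP.m≤m+n 5 _ ,
      ℕP.+-monoʳ-< 5 (subst (ℕ._< s) (sym (toℕ-↑ˡ i t)) (toℕ<n i)))

    tVertex∈T : ∀ j → T (inT s t (toℕ (tVertex j)))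
    tVertex∈T j rewrite toℕ-↑ʳ s j = from (T-inT {s}) (ℕP.+-monoʳ-≤ 5 (ℕP.m≤m+n s _) ,
      ℕP.+-monoʳ-< 5 (ℕP.+-monoʳ-< s (toℕ<n j)))

    S-colour : ∀ j → T (inS s (toℕ j)) → Σ (Fin s) λ i → lookup col j ≡ lookup u i
    S-colour (suc (suc (suc (suc (suc m))))) j∈S = fromℕ< m<s , VecP.lookup-++-< u v m m<s
      where
      m<s = ℕP.+-cancelˡ-< 5 _ _ (proj₂ (to T-inS j∈S))
    S-colour zero                          ()
    S-colour (suc zero)                    ()
    S-colour (suc (suc zero))              ()
    S-colour (suc (suc (suc zero)))        ()
    S-colour (suc (suc (suc (suc zero))))  ()

    T-colour : ∀ j → T (inT s t (toℕ j)) → Σ (Fin t) λ i → lookup col j ≡ lookup v i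
    T-colour (suc (suc (suc (suc (suc m))))) j∈T = reduce≥ m s≤m , VecP.lookup-++-≥ u v m s≤m
      where
      s≤m = ℕP.+-cancelˡ-≤ 5 _ _ (proj₁ (to (T-inT {s}) j∈T))
    T-colour zero                          ()
    T-colour (suc zero)                    ()
    T-colour (suc (suc zero))              ()
    T-colour (suc (suc (suc zero)))        ()
    T-colour (suc (suc (suc (suc zero))))  ()

  ProperX⇒edge-distinct : ProperX → ∀ i j → T (edgeX s t (toℕ i) (toℕ j)) → lookup col i ≢ lookup col j
  ProperX⇒edge-distinct (c₁≢c₂ , c₃≢c₄ , avoidS , avoidT) = edge
    where
    avoidS′ : ∀ j → T (inS s (toℕ j)) → All (_≢ lookup col j) (c₀ ∷ c₁ ∷ c₃ ∷ [])
    avoidS′ j j∈S with S-colour j j∈S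
    ... | i , eq rewrite eq = avoidS i
    avoidT′ : ∀ j → T (inT s t (toℕ j)) → All (_≢ lookup col j) (c₀ ∷ c₂ ∷ c₄ ∷ [])
    avoidT′ j j∈T with T-colour j j∈T
    ... | i , eq rewrite eq = avoidT i
    -- For each hub vᵢ, edgeX s t i b computes to a disjunction of tests on b alone.
    edge : ∀ i j → T (edgeX s t (toℕ i) (toℕ j)) → lookup col i ≢ lookup col j
    edge zero j e with to T-∨ e
    ... | inj₁ j∈S = All.head (avoidS′ j j∈S)
    ... | inj₂ j∈T = All.head (avoidT′ j j∈T)
    edge (suc zero) j e with to T-∨ e
    ... | inj₁ j≡2 = subst (c₁ ≢_) (cong (lookup col) (sym (toℕ-injective (ℕP.≡ᵇ⇒≡ (toℕ j) 2 j≡2)))) c₁≢c₂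
    ... | inj₂ e′ with to (T-∨ {inS s (toℕ j)}) e′
    ...   | inj₁ j∈S = All.head (All.tail (avoidS′ j j∈S))
    edge (suc (suc zero)) j j∈T = All.head (All.tail (avoidT′ j j∈T))
    edge (suc (suc (suc zero))) j e with to T-∨ e
    ... | inj₁ j≡4 = subst (c₃ ≢_) (cong (lookup col) (sym (toℕ-injective (ℕP.≡ᵇ⇒≡ (toℕ j) 4 j≡4)))) c₃≢c₄
    ... | inj₂ e′ with to (T-∨ {inS s (toℕ j)}) e′
    ...   | inj₁ j∈S = All.head (All.tail (All.tail (avoidS′ j j∈S)))
    edge (suc (suc (suc (suc zero)))) j j∈T = All.head (All.tail (All.tail (avoidT′ j j∈T)))
    edge (suc (suc (suc (suc (suc i))))) j ()

  ProperX⇒distinct : ProperX → ∀ i j → T (adj (X s t) i j) → lookup col i ≢ lookup col j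
  ProperX⇒distinct proper i j e with to T-∨ e
  ... | inj₁ i→j = ProperX⇒edge-distinct proper i j i→j
  ... | inj₂ j→i = ≢-sym (ProperX⇒edge-distinct proper j i j→i)

  distinct⇒ProperX : (∀ i j → T (adj (X s t) i j) → lookup col i ≢ lookup col j) → ProperX
  distinct⇒ProperX distinct = distinct (# 1) (# 2) tt , distinct (# 3) (# 4) tt , avoidS , avoidT
    where
    distinct→ : ∀ h w → T (edgeX s t (toℕ h) (toℕ w)) → lookup col h ≢ lookup col w
    distinct→ h w e = distinct h w (from (T-∨ {edgeX s t (toℕ h) (toℕ w)}) (inj₁ e))
    avoidS : ∀ i → All (_≢ lookup u i) (c₀ ∷ c₁ ∷ c₃ ∷ [])
    avoidS i rewrite sym (VecP.lookup-++ˡ u v i) =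
      distinct→ (# 0) w (from (T-∨ {inS s (toℕ w)}) (inj₁ w∈S)) ∷
      distinct→ (# 1) w (from (T-∨ {inS s (toℕ w)} {false}) (inj₁ w∈S)) ∷
      distinct→ (# 3) w (from (T-∨ {inS s (toℕ w)} {false}) (inj₁ w∈S)) ∷ []
      where
      w = sVertex i
      w∈S = sVertex∈S i
    avoidT : ∀ j → All (_≢ lookup v j) (c₀ ∷ c₂ ∷ c₄ ∷ [])
    avoidT j rewrite sym (VecP.lookup-++ʳ u v j) =
      distinct→ (# 0) w (from (T-∨ {inS s (toℕ w)}) (inj₂ w∈T)) ∷
      distinct→ (# 2) w w∈T ∷ distinct→ (# 4) w w∈T ∷ []
      where
      w = tVertex j
      w∈T = tVertex∈T j

  isProper-X : isProper (X s t) (c₀ ∷ c₁ ∷ c₂ ∷ c₃ ∷ c₄ ∷ u ++ v) ≡ properX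
  isProper-X = T-⇔⇒≡ (mk⇔
    (from T-properX ∘ distinct⇒ProperX ∘ to (T-isProper {G = X s t} {c = col}))
    (from (T-isProper {G = X s t} {c = col}) ∘ ProperX⇒distinct ∘ to T-properX))

-- Sums over the colours

sumℤ : List ℤ → ℤ
sumℤ = List.foldr _+_ (+ 0)

sum-constant : ∀ {k} (h : Fin k → ℤ) c → (∀ d → h d ≡ c) → ∑[ d < k ] h d ≡ + k * c
sum-constant {zero}  h c _     = sym (ℤP.*-zeroˡ c)
sum-constant {suc k} h c h≡c rewrite h≡c zero | sum-constant (h ∘ suc) c (h≡c ∘ suc) =
  sym (ℤP.suc-* (+ k) c)

sum-updateAt : ∀ {k} (h : Fin k → ℤ) u c →
  ∑[ d < k ] h d + c ≡ h u + ∑[ d < k ] updateAt h u (const c) d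
sum-updateAt {suc k} h zero    c = shuffle (h zero) (∑[ d < k ] h (suc d)) c
  where
  shuffle : ∀ a b c → a + b + c ≡ a + (c + b)
  shuffle = solve-∀
sum-updateAt {suc k} h (suc u) c rewrite ℤP.+-assoc (h zero) (∑[ d < k ] h (suc d)) c
                                       | sum-updateAt (h ∘ suc) u c =
  shuffle (h zero) (h (suc u)) (∑[ d < k ] updateAt (h ∘ suc) u (const c) d)
  where
  shuffle : ∀ a b c → a + (b + c) ≡ b + (a + c)
  shuffle = solve-∀

sum-pointwise : ∀ {k} (h : Fin k → ℤ) c us ws → AllPairs _≢_ us → Pointwise (λ u w → h u ≡ w) us ws →
  (∀ d → All (d ≢_) us → h d ≡ c) → ∑[ d < k ] h d ≡ sumℤ ws + (+ k - + length us) * c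
sum-pointwise {k} h c [] [] [] [] off =
  trans (sum-constant h c (λ d → off d [])) (normalise (+ k) c)
  where
  normalise : ∀ K c → K * c ≡ + 0 + (K - + 0) * c
  normalise = solve-∀
sum-pointwise {k} h c (u ∷ us) (w ∷ ws) (u≢us ∷ distinct) (hu≡w ∷ values) off = begin
  ∑[ d < k ] h d                                     ≡⟨ add-sub (∑[ d < k ] h d) c ⟩
  ∑[ d < k ] h d + c - c                             ≡⟨ cong (_- c) (sum-updateAt h u c) ⟩
  h u + ∑[ d < k ] h′ d - c                          ≡⟨ cong₂ (λ a b → a + b - c) hu≡w
                                                         (sum-pointwise h′ c us ws distinct (values′ us ws u≢us values) off′) ⟩
  w + (sumℤ ws + (+ k - + length us) * c) - c        ≡⟨ normalise w (sumℤ ws) (+ k) (+ length us) c ⟩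
  w + sumℤ ws + (+ k - (+ 1 + + length us)) * c      ∎
  where
  open ≡-Reasoning
  h′ = updateAt h u (const c)
  add-sub : ∀ a c → a ≡ a + c - c
  add-sub = solve-∀
  normalise : ∀ w S K N c → w + (S + (K - N) * c) - c ≡ w + S + (K - (+ 1 + N)) * c
  normalise = solve-∀
  values′ : ∀ vs ws → All (u ≢_) vs → Pointwise (λ v w → h v ≡ w) vs ws → Pointwise (λ v w → h′ v ≡ w) vs ws
  values′ []       []       []            []              = []
  values′ (v ∷ vs) (w ∷ ws) (u≢v ∷ u≢vs) (hv≡w ∷ values) =
    trans (updateAt-minimal v u h (≢-sym u≢v)) hv≡w ∷ values′ vs ws u≢vs values
  off′ : ∀ d → All (d ≢_) us → h′ d ≡ c
  off′ d d≢us with d ≟ u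
  ... | yes refl = updateAt-updates u h
  ... | no  d≢u  = trans (updateAt-minimal d u h d≢u) (off d (d≢u ∷ d≢us))

module _ {k : ℕ} where

  𝟙-≠ᵇ-refl : ∀ (a : Fin k) x → 𝟙 (a ≠ᵇ a) * x ≡ + 0
  𝟙-≠ᵇ-refl a x with a ≟ a
  ... | yes _   = refl
  ... | no  a≢a = ⊥-elim (a≢a refl)

  𝟙-≠ᵇ : ∀ {a b : Fin k} x → a ≢ b → 𝟙 (a ≠ᵇ b) * x ≡ x
  𝟙-≠ᵇ {a} {b} x a≢b with a ≟ b
  ... | yes a≡b = ⊥-elim (a≢b a≡b)
  ... | no  _   = ℤP.*-identityˡ x

  𝟙-avoids-∈ : ∀ {cs} {d : Fin k} → d ∈ cs → 𝟙 (avoids cs d) ≡ + 0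
  𝟙-avoids-∈ {cs} {d} d∈cs with avoids cs d in eq
  ... | false = refl
  ... | true  = ⊥-elim (All.lookup (to T-avoids (subst T (sym eq) tt)) d∈cs refl)

  𝟙-avoids-∉ : ∀ {cs} {d : Fin k} → All (_≢ d) cs → 𝟙 (avoids cs d) ≡ + 1
  𝟙-avoids-∉ {cs} {d} cs≢d with avoids cs d in eq
  ... | true  = refl
  ... | false = ⊥-elim (subst T eq (from T-avoids cs≢d))

  available : List (Fin k) → ℤ
  available cs = ∑[ d < k ] 𝟙 (avoids cs d)

  -- us is a duplicate-free list of the colours occurring in cs.
  available-≡ : ∀ cs us → AllPairs _≢_ us → All (_∈ cs) us → (∀ d → All (d ≢_) us → All (_≢ d) cs) →
    available cs ≡ + k - + length us
  available-≡ cs us distinct us⊆cs off = begin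
    available cs
      ≡⟨ sum-pointwise _ (+ 1) us zeros distinct (at-zeros us us⊆cs) (λ d → 𝟙-avoids-∉ ∘ off d) ⟩
    sumℤ zeros + (+ k - + length us) * + 1
      ≡⟨ cong₂ _+_ (sumℤ-zeros us) (ℤP.*-identityʳ (+ k - + length us)) ⟩
    + 0 + (+ k - + length us)
      ≡⟨ ℤP.+-identityˡ _ ⟩
    + k - + length us ∎
    where
    open ≡-Reasoning
    zeros = List.map (const (+ 0)) us
    at-zeros : ∀ vs → All (_∈ cs) vs → Pointwise (λ v w → 𝟙 (avoids cs v) ≡ w) vs (List.map (const (+ 0)) vs)
    at-zeros []       []             = []
    at-zeros (v ∷ vs) (v∈cs ∷ vs⊆cs) = 𝟙-avoids-∈ v∈cs ∷ at-zeros vs vs⊆cs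
    sumℤ-zeros : ∀ vs → sumℤ (List.map (const (+ 0)) vs) ≡ + 0
    sumℤ-zeros []       = refl
    sumℤ-zeros (v ∷ vs) = trans (ℤP.+-identityˡ _) (sumℤ-zeros vs)

-- The chromatic polynomial of X(s, t)

module ChromaticForm where

  x S₁ S₂ S₃ T₁ T₂ T₃ : Expr 7
  x  = var (# 0)
  S₁ = var (# 1)
  S₂ = var (# 2)
  S₃ = var (# 3)
  T₁ = var (# 4)
  T₂ = var (# 5)
  T₃ = var (# 6)

  infixl 6 _⊖_
  _⊖_ : Expr 7 → ℕ → Expr 7
  e ⊖ a = e ⊕ con (- + a)

  -- Sᵢ and Tᵢ stand for (x - i)ˢ and (x - i)ᵗ.  Given the colours of v₀, v₂, v₃, the
  -- colourings of v₄ and T number γ, δ, α or β according as v₀ = v₂ = v₃, v₀ = v₂ ≠ v₃,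
  -- v₀ ≠ v₂ with v₃ ∈ {v₀, v₂}, or all three distinct.  Given the colours of v₀, v₁, v₂, the
  -- colourings of v₃, v₄, S, T number X₁, X₂ or X₃ according as v₀ = v₁, v₀ = v₂, or all distinct.
  γ δ α β X₁ X₂ X₃ chromatic : Expr 7
  γ = (x ⊖ 1) ⊗ T₂
  δ = T₁ ⊕ (x ⊖ 2) ⊗ T₂
  α = T₂ ⊕ (x ⊖ 2) ⊗ T₃
  β = T₂ ⊕ T₂ ⊕ (x ⊖ 3) ⊗ T₃
  X₁ = S₁ ⊗ α ⊕ S₂ ⊗ α ⊕ (x ⊖ 2) ⊗ (S₂ ⊗ β)
  X₂ = S₂ ⊗ γ ⊕ S₂ ⊗ δ ⊕ (x ⊖ 2) ⊗ (S₃ ⊗ δ)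
  X₃ = S₂ ⊗ α ⊕ S₂ ⊗ β ⊕ S₃ ⊗ α ⊕ (x ⊖ 3) ⊗ (S₃ ⊗ β)
  chromatic = x ⊗ ((x ⊖ 1) ⊗ X₁ ⊕ (x ⊖ 1) ⊗ (X₂ ⊕ (x ⊖ 2) ⊗ X₃))

module ColourSums (s t k : ℕ) where
  open ChromaticForm

  K : ℤ
  K = + k

  ⟪_⟫ : Expr 7 → ℤ
  ⟪ e ⟫ = ⟦ e ⟧ (K ∷ (K - + 1) ^ s ∷ (K - + 2) ^ s ∷ (K - + 3) ^ s ∷ (K - + 1) ^ t ∷ (K - + 2) ^ t ∷ (K - + 3) ^ t ∷ [])

  available-aaa : ∀ a → available {k} (a ∷ a ∷ a ∷ []) ≡ K - + 1
  available-aaa a = available-≡ _ (a ∷ []) ([] ∷ []) (here refl ∷ [])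
    λ { d (d≢a ∷ []) → ≢-sym d≢a ∷ ≢-sym d≢a ∷ ≢-sym d≢a ∷ [] }

  available-aab : ∀ {a b} → a ≢ b → available {k} (a ∷ a ∷ b ∷ []) ≡ K - + 2
  available-aab a≢b = available-≡ _ (_ ∷ _ ∷ []) ((a≢b ∷ []) ∷ [] ∷ []) (here refl ∷ there (there (here refl)) ∷ [])
    λ { d (d≢a ∷ d≢b ∷ []) → ≢-sym d≢a ∷ ≢-sym d≢a ∷ ≢-sym d≢b ∷ [] }

  available-aba : ∀ {a b} → a ≢ b → available {k} (a ∷ b ∷ a ∷ []) ≡ K - + 2
  available-aba a≢b = available-≡ _ (_ ∷ _ ∷ []) ((a≢b ∷ []) ∷ [] ∷ []) (here refl ∷ there (here refl) ∷ [])
    λ { d (d≢a ∷ d≢b ∷ []) → ≢-sym d≢a ∷ ≢-sym d≢b ∷ ≢-sym d≢a ∷ [] }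

  available-abb : ∀ {a b} → a ≢ b → available {k} (a ∷ b ∷ b ∷ []) ≡ K - + 2
  available-abb a≢b = available-≡ _ (_ ∷ _ ∷ []) ((a≢b ∷ []) ∷ [] ∷ []) (here refl ∷ there (here refl) ∷ [])
    λ { d (d≢a ∷ d≢b ∷ []) → ≢-sym d≢a ∷ ≢-sym d≢b ∷ ≢-sym d≢b ∷ [] }

  available-abc : ∀ {a b c} → a ≢ b → a ≢ c → b ≢ c → available {k} (a ∷ b ∷ c ∷ []) ≡ K - + 3
  available-abc a≢b a≢c b≢c =
    available-≡ _ (_ ∷ _ ∷ _ ∷ []) ((a≢b ∷ a≢c ∷ []) ∷ (b≢c ∷ []) ∷ [] ∷ [])
      (here refl ∷ there (here refl) ∷ there (there (here refl)) ∷ [])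
      λ { d (d≢a ∷ d≢b ∷ d≢c ∷ []) → ≢-sym d≢a ∷ ≢-sym d≢b ∷ ≢-sym d≢c ∷ [] }

  ways₄ : Fin k → Fin k → Fin k → ℤ
  ways₄ c₀ c₂ c₃ = ∑[ c₄ < k ] (𝟙 (c₃ ≠ᵇ c₄) * available (c₀ ∷ c₂ ∷ c₄ ∷ []) ^ t)

  ways₄-aaa : ∀ a → ways₄ a a a ≡ ⟪ γ ⟫
  ways₄-aaa a = trans
    (sum-pointwise _ ⟪ T₂ ⟫ (a ∷ []) (+ 0 ∷ []) ([] ∷ []) (𝟙-≠ᵇ-refl a _ ∷ [])
      λ { d (d≢a ∷ []) → trans (𝟙-≠ᵇ _ (≢-sym d≢a)) (cong (_^ t) (available-aab (≢-sym d≢a))) })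
    (normalise K ⟪ T₂ ⟫)
    where
    normalise : ∀ K T → + 0 + + 0 + (K - + 1) * T ≡ (K - + 1) * T
    normalise = solve-∀

  ways₄-aab : ∀ {a b} → a ≢ b → ways₄ a a b ≡ ⟪ δ ⟫
  ways₄-aab {a} {b} a≢b = trans
    (sum-pointwise _ ⟪ T₂ ⟫ (a ∷ b ∷ []) (⟪ T₁ ⟫ ∷ + 0 ∷ []) ((a≢b ∷ []) ∷ [] ∷ [])
      (trans (𝟙-≠ᵇ _ (≢-sym a≢b)) (cong (_^ t) (available-aaa a)) ∷ 𝟙-≠ᵇ-refl b _ ∷ [])
      λ { d (d≢a ∷ d≢b ∷ []) → trans (𝟙-≠ᵇ _ (≢-sym d≢b)) (cong (_^ t) (available-aab (≢-sym d≢a))) })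
    (normalise K ⟪ T₁ ⟫ ⟪ T₂ ⟫)
    where
    normalise : ∀ K T₁ T₂ → T₁ + (+ 0 + + 0) + (K - + 2) * T₂ ≡ T₁ + (K - + 2) * T₂
    normalise = solve-∀

  ways₄-aba : ∀ {a b} → a ≢ b → ways₄ a b a ≡ ⟪ α ⟫
  ways₄-aba {a} {b} a≢b = trans
    (sum-pointwise _ ⟪ T₃ ⟫ (a ∷ b ∷ []) (+ 0 ∷ ⟪ T₂ ⟫ ∷ []) ((a≢b ∷ []) ∷ [] ∷ [])
      (𝟙-≠ᵇ-refl a _ ∷ trans (𝟙-≠ᵇ _ a≢b) (cong (_^ t) (available-abb a≢b)) ∷ [])
      λ { d (d≢a ∷ d≢b ∷ []) →
            trans (𝟙-≠ᵇ _ (≢-sym d≢a)) (cong (_^ t) (available-abc a≢b (≢-sym d≢a) (≢-sym d≢b))) })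
    (normalise K ⟪ T₂ ⟫ ⟪ T₃ ⟫)
    where
    normalise : ∀ K T₂ T₃ → + 0 + (T₂ + + 0) + (K - + 2) * T₃ ≡ T₂ + (K - + 2) * T₃
    normalise = solve-∀

  ways₄-abb : ∀ {a b} → a ≢ b → ways₄ a b b ≡ ⟪ α ⟫
  ways₄-abb {a} {b} a≢b = trans
    (sum-pointwise _ ⟪ T₃ ⟫ (a ∷ b ∷ []) (⟪ T₂ ⟫ ∷ + 0 ∷ []) ((a≢b ∷ []) ∷ [] ∷ [])
      (trans (𝟙-≠ᵇ _ (≢-sym a≢b)) (cong (_^ t) (available-aba a≢b)) ∷ 𝟙-≠ᵇ-refl b _ ∷ [])
      λ { d (d≢a ∷ d≢b ∷ []) →
            trans (𝟙-≠ᵇ _ (≢-sym d≢b)) (cong (_^ t) (available-abc a≢b (≢-sym d≢a) (≢-sym d≢b))) })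
    (normalise K ⟪ T₂ ⟫ ⟪ T₃ ⟫)
    where
    normalise : ∀ K T₂ T₃ → T₂ + (+ 0 + + 0) + (K - + 2) * T₃ ≡ T₂ + (K - + 2) * T₃
    normalise = solve-∀

  ways₄-abc : ∀ {a b c} → a ≢ b → a ≢ c → b ≢ c → ways₄ a b c ≡ ⟪ β ⟫
  ways₄-abc {a} {b} {c} a≢b a≢c b≢c = trans
    (sum-pointwise _ ⟪ T₃ ⟫ (a ∷ b ∷ c ∷ []) (⟪ T₂ ⟫ ∷ ⟪ T₂ ⟫ ∷ + 0 ∷ [])
      ((a≢b ∷ a≢c ∷ []) ∷ (b≢c ∷ []) ∷ [] ∷ [])
      (trans (𝟙-≠ᵇ _ (≢-sym a≢c)) (cong (_^ t) (available-aba a≢b)) ∷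
       trans (𝟙-≠ᵇ _ (≢-sym b≢c)) (cong (_^ t) (available-abb a≢b)) ∷
       𝟙-≠ᵇ-refl c _ ∷ [])
      λ { d (d≢a ∷ d≢b ∷ d≢c ∷ []) →
            trans (𝟙-≠ᵇ _ (≢-sym d≢c)) (cong (_^ t) (available-abc a≢b (≢-sym d≢a) (≢-sym d≢b))) })
    (normalise K ⟪ T₂ ⟫ ⟪ T₃ ⟫)
    where
    normalise : ∀ K T₂ T₃ → T₂ + (T₂ + (+ 0 + + 0)) + (K - + 3) * T₃ ≡ T₂ + T₂ + (K - + 3) * T₃
    normalise = solve-∀

  ways₃ : Fin k → Fin k → Fin k → ℤ
  ways₃ c₀ c₁ c₂ = ∑[ c₃ < k ] (available (c₀ ∷ c₁ ∷ c₃ ∷ []) ^ s * ways₄ c₀ c₂ c₃)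

  ways₃-aab : ∀ {a b} → a ≢ b → ways₃ a a b ≡ ⟪ X₁ ⟫
  ways₃-aab {a} {b} a≢b = trans
    (sum-pointwise _ (⟪ S₂ ⟫ * ⟪ β ⟫) (a ∷ b ∷ []) (⟪ S₁ ⟫ * ⟪ α ⟫ ∷ ⟪ S₂ ⟫ * ⟪ α ⟫ ∷ [])
      ((a≢b ∷ []) ∷ [] ∷ [])
      (cong₂ _*_ (cong (_^ s) (available-aaa a)) (ways₄-aba a≢b) ∷
       cong₂ _*_ (cong (_^ s) (available-aab a≢b)) (ways₄-abb a≢b) ∷ [])
      λ { d (d≢a ∷ d≢b ∷ []) →
            cong₂ _*_ (cong (_^ s) (available-aab (≢-sym d≢a))) (ways₄-abc a≢b (≢-sym d≢a) (≢-sym d≢b)) })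
    (normalise K ⟪ S₁ ⟫ ⟪ S₂ ⟫ ⟪ α ⟫ ⟪ β ⟫)
    where
    normalise : ∀ K S₁ S₂ α β →
      S₁ * α + (S₂ * α + + 0) + (K - + 2) * (S₂ * β) ≡ S₁ * α + S₂ * α + (K - + 2) * (S₂ * β)
    normalise = solve-∀

  ways₃-aba : ∀ {a b} → a ≢ b → ways₃ a b a ≡ ⟪ X₂ ⟫
  ways₃-aba {a} {b} a≢b = trans
    (sum-pointwise _ (⟪ S₃ ⟫ * ⟪ δ ⟫) (a ∷ b ∷ []) (⟪ S₂ ⟫ * ⟪ γ ⟫ ∷ ⟪ S₂ ⟫ * ⟪ δ ⟫ ∷ [])
      ((a≢b ∷ []) ∷ [] ∷ [])
      (cong₂ _*_ (cong (_^ s) (available-aba a≢b)) (ways₄-aaa a) ∷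
       cong₂ _*_ (cong (_^ s) (available-abb a≢b)) (ways₄-aab a≢b) ∷ [])
      λ { d (d≢a ∷ d≢b ∷ []) →
            cong₂ _*_ (cong (_^ s) (available-abc a≢b (≢-sym d≢a) (≢-sym d≢b))) (ways₄-aab (≢-sym d≢a)) })
    (normalise K ⟪ S₂ ⟫ ⟪ S₃ ⟫ ⟪ γ ⟫ ⟪ δ ⟫)
    where
    normalise : ∀ K S₂ S₃ γ δ →
      S₂ * γ + (S₂ * δ + + 0) + (K - + 2) * (S₃ * δ) ≡ S₂ * γ + S₂ * δ + (K - + 2) * (S₃ * δ)
    normalise = solve-∀

  ways₃-abc : ∀ {a b c} → a ≢ b → a ≢ c → b ≢ c → ways₃ a b c ≡ ⟪ X₃ ⟫
  ways₃-abc {a} {b} {c} a≢b a≢c b≢c = trans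
    (sum-pointwise _ (⟪ S₃ ⟫ * ⟪ β ⟫) (a ∷ b ∷ c ∷ [])
      (⟪ S₂ ⟫ * ⟪ α ⟫ ∷ ⟪ S₂ ⟫ * ⟪ β ⟫ ∷ ⟪ S₃ ⟫ * ⟪ α ⟫ ∷ [])
      ((a≢b ∷ a≢c ∷ []) ∷ (b≢c ∷ []) ∷ [] ∷ [])
      (cong₂ _*_ (cong (_^ s) (available-aba a≢b)) (ways₄-aba a≢c) ∷
       cong₂ _*_ (cong (_^ s) (available-abb a≢b)) (ways₄-abc a≢c a≢b (≢-sym b≢c)) ∷
       cong₂ _*_ (cong (_^ s) (available-abc a≢b a≢c b≢c)) (ways₄-abb a≢c) ∷ [])
      λ { d (d≢a ∷ d≢b ∷ d≢c ∷ []) →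
            cong₂ _*_ (cong (_^ s) (available-abc a≢b (≢-sym d≢a) (≢-sym d≢b)))
                      (ways₄-abc a≢c (≢-sym d≢a) (≢-sym d≢c)) })
    (normalise K ⟪ S₂ ⟫ ⟪ S₃ ⟫ ⟪ α ⟫ ⟪ β ⟫)
    where
    normalise : ∀ K S₂ S₃ α β →
      S₂ * α + (S₂ * β + (S₃ * α + + 0)) + (K - + 3) * (S₃ * β) ≡
      S₂ * α + S₂ * β + S₃ * α + (K - + 3) * (S₃ * β)
    normalise = solve-∀

  ways₂ : Fin k → Fin k → ℤ
  ways₂ c₀ c₁ = ∑[ c₂ < k ] (𝟙 (c₁ ≠ᵇ c₂) * ways₃ c₀ c₁ c₂)

  ways₂-aa : ∀ a → ways₂ a a ≡ ⟪ (x ⊖ 1) ⊗ X₁ ⟫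
  ways₂-aa a = trans
    (sum-pointwise _ ⟪ X₁ ⟫ (a ∷ []) (+ 0 ∷ []) ([] ∷ []) (𝟙-≠ᵇ-refl a _ ∷ [])
      λ { d (d≢a ∷ []) → trans (𝟙-≠ᵇ _ (≢-sym d≢a)) (ways₃-aab (≢-sym d≢a)) })
    (normalise K ⟪ X₁ ⟫)
    where
    normalise : ∀ K X → + 0 + + 0 + (K - + 1) * X ≡ (K - + 1) * X
    normalise = solve-∀

  ways₂-ab : ∀ {a b} → a ≢ b → ways₂ a b ≡ ⟪ X₂ ⊕ (x ⊖ 2) ⊗ X₃ ⟫
  ways₂-ab {a} {b} a≢b = trans
    (sum-pointwise _ ⟪ X₃ ⟫ (a ∷ b ∷ []) (⟪ X₂ ⟫ ∷ + 0 ∷ []) ((a≢b ∷ []) ∷ [] ∷ [])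
      (trans (𝟙-≠ᵇ _ (≢-sym a≢b)) (ways₃-aba a≢b) ∷ 𝟙-≠ᵇ-refl b _ ∷ [])
      λ { d (d≢a ∷ d≢b ∷ []) → trans (𝟙-≠ᵇ _ (≢-sym d≢b)) (ways₃-abc a≢b (≢-sym d≢a) (≢-sym d≢b)) })
    (normalise K ⟪ X₂ ⟫ ⟪ X₃ ⟫)
    where
    normalise : ∀ K X₂ X₃ → X₂ + (+ 0 + + 0) + (K - + 2) * X₃ ≡ X₂ + (K - + 2) * X₃
    normalise = solve-∀

  ways₁ : Fin k → ℤ
  ways₁ c₀ = ∑[ c₁ < k ] ways₂ c₀ c₁

  ways₁-a : ∀ a → ways₁ a ≡ ⟪ (x ⊖ 1) ⊗ X₁ ⊕ (x ⊖ 1) ⊗ (X₂ ⊕ (x ⊖ 2) ⊗ X₃) ⟫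
  ways₁-a a = trans
    (sum-pointwise _ ⟪ X₂ ⊕ (x ⊖ 2) ⊗ X₃ ⟫ (a ∷ []) (⟪ (x ⊖ 1) ⊗ X₁ ⟫ ∷ []) ([] ∷ [])
      (ways₂-aa a ∷ []) λ { d (d≢a ∷ []) → ways₂-ab (≢-sym d≢a) })
    (cong (λ y → y + (K - + 1) * ⟪ X₂ ⊕ (x ⊖ 2) ⊗ X₃ ⟫) (ℤP.+-identityʳ ⟪ (x ⊖ 1) ⊗ X₁ ⟫))

  sum-ways₁ : ∑[ c₀ < k ] ways₁ c₀ ≡ ⟪ chromatic ⟫
  sum-ways₁ = sum-constant ways₁ _ ways₁-a

  extensions₅ : ∀ c₀ c₁ c₂ c₃ c₄ →
    countColourings (s ℕ.+ t) (λ w → isProper (X s t) (c₀ ∷ c₁ ∷ c₂ ∷ c₃ ∷ c₄ ∷ w))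
      ≡ 𝟙 (c₁ ≠ᵇ c₂) * (available (c₀ ∷ c₁ ∷ c₃ ∷ []) ^ s
                        * (𝟙 (c₃ ≠ᵇ c₄) * available (c₀ ∷ c₂ ∷ c₄ ∷ []) ^ t))
  extensions₅ c₀ c₁ c₂ c₃ c₄ = begin
    countColourings (s ℕ.+ t) (λ w → isProper (X s t) (c₀ ∷ c₁ ∷ c₂ ∷ c₃ ∷ c₄ ∷ w))
      ≡⟨ countColourings-++ s t _ (λ u → edges ∧ allB (avoids Sᶜ) (Vec.toList u)) (allB (avoids Tᶜ) ∘ Vec.toList)
           (isProper-X c₀ c₁ c₂ c₃ c₄) ⟩
    count (λ u → edges ∧ allB (avoids Sᶜ) (Vec.toList u)) (allColourings s k) * countColourings t (allB (avoids Tᶜ) ∘ Vec.toList)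
      ≡⟨ cong₂ _*_ (trans (count-∧ edges _ (allColourings s k)) (cong (𝟙 edges *_) (countColourings-all s (avoids Sᶜ))))
                   (countColourings-all t (avoids Tᶜ)) ⟩
    𝟙 (c₁ ≠ᵇ c₂ ∧ c₃ ≠ᵇ c₄) * available Sᶜ ^ s * available Tᶜ ^ t
      ≡⟨ cong (λ e → e * available Sᶜ ^ s * available Tᶜ ^ t) (𝟙-∧ (c₁ ≠ᵇ c₂) (c₃ ≠ᵇ c₄)) ⟩
    𝟙 (c₁ ≠ᵇ c₂) * 𝟙 (c₃ ≠ᵇ c₄) * available Sᶜ ^ s * available Tᶜ ^ t
      ≡⟨ shuffle (𝟙 (c₁ ≠ᵇ c₂)) (𝟙 (c₃ ≠ᵇ c₄)) (available Sᶜ ^ s) (available Tᶜ ^ t) ⟩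
    𝟙 (c₁ ≠ᵇ c₂) * (available Sᶜ ^ s * (𝟙 (c₃ ≠ᵇ c₄) * available Tᶜ ^ t)) ∎
    where
    open ≡-Reasoning
    edges = c₁ ≠ᵇ c₂ ∧ c₃ ≠ᵇ c₄
    Sᶜ = c₀ ∷ c₁ ∷ c₃ ∷ []
    Tᶜ = c₀ ∷ c₂ ∷ c₄ ∷ []
    shuffle : ∀ a b A B → a * b * A * B ≡ a * (A * (b * B))
    shuffle = solve-∀

  extensions₄ : ∀ c₀ c₁ c₂ c₃ →
    countColourings (suc (s ℕ.+ t)) (λ w → isProper (X s t) (c₀ ∷ c₁ ∷ c₂ ∷ c₃ ∷ w))
      ≡ 𝟙 (c₁ ≠ᵇ c₂) * (available (c₀ ∷ c₁ ∷ c₃ ∷ []) ^ s * ways₄ c₀ c₂ c₃)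
  extensions₄ c₀ c₁ c₂ c₃ = begin
    countColourings (suc (s ℕ.+ t)) (λ w → isProper (X s t) (c₀ ∷ c₁ ∷ c₂ ∷ c₃ ∷ w))
      ≡⟨ countColourings-suc (s ℕ.+ t) (λ w → isProper (X s t) (c₀ ∷ c₁ ∷ c₂ ∷ c₃ ∷ w)) ⟩
    ∑[ c₄ < k ] countColourings (s ℕ.+ t) (λ w → isProper (X s t) (c₀ ∷ c₁ ∷ c₂ ∷ c₃ ∷ c₄ ∷ w))
      ≡⟨ sum-cong-≗ (extensions₅ c₀ c₁ c₂ c₃) ⟩
    ∑[ c₄ < k ] (edge₁₂ * (availableˢ * (𝟙 (c₃ ≠ᵇ c₄) * available (c₀ ∷ c₂ ∷ c₄ ∷ []) ^ t)))
      ≡⟨ *-distribˡ-sum edge₁₂ (λ c₄ → availableˢ * (𝟙 (c₃ ≠ᵇ c₄) * available (c₀ ∷ c₂ ∷ c₄ ∷ []) ^ t)) ⟨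
    edge₁₂ * ∑[ c₄ < k ] (availableˢ * (𝟙 (c₃ ≠ᵇ c₄) * available (c₀ ∷ c₂ ∷ c₄ ∷ []) ^ t))
      ≡⟨ cong (edge₁₂ *_) (*-distribˡ-sum availableˢ (λ c₄ → 𝟙 (c₃ ≠ᵇ c₄) * available (c₀ ∷ c₂ ∷ c₄ ∷ []) ^ t)) ⟨
    edge₁₂ * (availableˢ * ways₄ c₀ c₂ c₃) ∎
    where
    open ≡-Reasoning
    edge₁₂ = 𝟙 (c₁ ≠ᵇ c₂)
    availableˢ = available (c₀ ∷ c₁ ∷ c₃ ∷ []) ^ s

  extensions₃ : ∀ c₀ c₁ c₂ →
    countColourings (2 ℕ.+ (s ℕ.+ t)) (λ w → isProper (X s t) (c₀ ∷ c₁ ∷ c₂ ∷ w))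
      ≡ 𝟙 (c₁ ≠ᵇ c₂) * ways₃ c₀ c₁ c₂
  extensions₃ c₀ c₁ c₂ = trans (countColourings-suc _ (λ w → isProper (X s t) (c₀ ∷ c₁ ∷ c₂ ∷ w)))
    (trans (sum-cong-≗ (extensions₄ c₀ c₁ c₂))
      (sym (*-distribˡ-sum (𝟙 (c₁ ≠ᵇ c₂))
                            (λ c₃ → available (c₀ ∷ c₁ ∷ c₃ ∷ []) ^ s * ways₄ c₀ c₂ c₃))))

  extensions₂ : ∀ c₀ c₁ →
    countColourings (3 ℕ.+ (s ℕ.+ t)) (λ w → isProper (X s t) (c₀ ∷ c₁ ∷ w)) ≡ ways₂ c₀ c₁
  extensions₂ c₀ c₁ =
    trans (countColourings-suc _ (λ w → isProper (X s t) (c₀ ∷ c₁ ∷ w))) (sum-cong-≗ (extensions₃ c₀ c₁))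

  extensions₁ : ∀ c₀ → countColourings (4 ℕ.+ (s ℕ.+ t)) (λ w → isProper (X s t) (c₀ ∷ w)) ≡ ways₁ c₀
  extensions₁ c₀ =
    trans (countColourings-suc _ (λ w → isProper (X s t) (c₀ ∷ w))) (sum-cong-≗ (extensions₂ c₀))

  numColourings-X : + numColourings (X s t) k ≡ ∑[ c₀ < k ] ways₁ c₀
  numColourings-X =
    trans (length-filter (isProper (X s t)) (allColourings (order (X s t)) k))
      (trans (countColourings-suc {k} (4 ℕ.+ (s ℕ.+ t)) (isProper (X s t))) (sum-cong-≗ extensions₁))

𝕩 : Poly
𝕩 = + 0 ∷ + 1 ∷ []

leaves : ℕ → ℕ → Vec Poly 7
leaves s t = 𝕩 ∷ linearFactor (+ 1) ^ₚ s ∷ linearFactor (+ 2) ^ₚ s ∷ linearFactor (+ 3) ^ₚ s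
               ∷ linearFactor (+ 1) ^ₚ t ∷ linearFactor (+ 2) ^ₚ t ∷ linearFactor (+ 3) ^ₚ t ∷ []

chromaticPolynomial : ℕ → ℕ → Poly
chromaticPolynomial s t = toPoly (leaves s t) ChromaticForm.chromatic

eval-leaf : ∀ a n x → eval (linearFactor a ^ₚ n) x ≡ (x - a) ^ n
eval-leaf a n x = trans (eval-^ₚ (linearFactor a) n x) (cong (_^ n) (eval-linearFactor a x))

chromaticPolynomial-isChromatic : ∀ s t → IsChromaticPolynomial (X s t) (chromaticPolynomial s t)
chromaticPolynomial-isChromatic s t k = begin
  eval (chromaticPolynomial s t) (+ k)                 ≡⟨ eval-toPoly (leaves s t) chromatic (+ k) ⟩
  ⟦ chromatic ⟧ (values (leaves s t) (+ k))            ≡⟨ cong ⟦ chromatic ⟧ leafValues ⟩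
  ⟪ chromatic ⟫                                        ≡⟨ sum-ways₁ ⟨
  ∑[ c₀ < k ] ways₁ c₀                               ≡⟨ numColourings-X ⟨
  + numColourings (X s t) k                            ∎
  where
  open ≡-Reasoning
  open ChromaticForm using (chromatic)
  open ColourSums s t k
  leafValues : values (leaves s t) (+ k) ≡ K ∷ (K - + 1) ^ s ∷ (K - + 2) ^ s ∷ (K - + 3) ^ s
                                             ∷ (K - + 1) ^ t ∷ (K - + 2) ^ t ∷ (K - + 3) ^ t ∷ []
  leafValues = cong₂ _∷_ (normalise K) (cong₂ _∷_ (eval-leaf (+ 1) s K) (cong₂ _∷_ (eval-leaf (+ 2) s K)
    (cong₂ _∷_ (eval-leaf (+ 3) s K) (cong₂ _∷_ (eval-leaf (+ 1) t K) (cong₂ _∷_ (eval-leaf (+ 2) t K)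
    (cong₂ _∷_ (eval-leaf (+ 3) t K) refl))))))
    where
    normalise : ∀ x → + 0 + x * (+ 1 + x * + 0) ≡ x
    normalise = solve-∀

∂chromatic-at-2 : ∀ σ τ a b c d →
  ⟦ ∂ ChromaticForm.chromatic ⟧ (+ 2 ∷ + 1 ∷ + 0 ∷ σ ∷ + 1 ∷ + 0 ∷ τ ∷ + 1 ∷ a ∷ + 0 ∷ b ∷ c ∷ + 0 ∷ d ∷ [])
    ≡ + 2 * (σ + τ + σ * τ)
∂chromatic-at-2 σ τ a b c d = begin
  ⟦ ∂ chromatic ⟧ (Vec.map (λ w → SolverOps.⟦ w ⟧ ρ) at2) ≡⟨ ⟦reify⟧ at2 (∂ chromatic) ρ ⟨
  SolverOps.⟦ reify at2 (∂ chromatic) ⟧ ρ   ≡⟨ SolverOps.correct (reify at2 (∂ chromatic)) ρ ⟨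
  SolverOps.⟦ reify at2 (∂ chromatic) ⇓⟧ ρ  ≡⟨⟩
  SolverOps.⟦ target ⇓⟧ ρ                   ≡⟨ SolverOps.correct target ρ ⟩
  + 2 * (σ + τ + σ * τ)                     ∎
  where
  open ≡-Reasoning
  open ChromaticForm using (chromatic)
  open Solver using (Κ; Ι; _⊕_; _⊗_)
  ρ = σ ∷ τ ∷ a ∷ b ∷ c ∷ d ∷ []
  at2 : Vec (Solver.Expr ℤ 6) 14
  at2 = Κ (+ 2) ∷ Κ (+ 1) ∷ Κ (+ 0) ∷ Ι (# 0) ∷ Κ (+ 1) ∷ Κ (+ 0) ∷ Ι (# 1)
      ∷ Κ (+ 1) ∷ Ι (# 2) ∷ Κ (+ 0) ∷ Ι (# 3) ∷ Ι (# 4) ∷ Κ (+ 0) ∷ Ι (# 5) ∷ []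
  target : Solver.Expr ℤ 6
  target = Κ (+ 2) ⊗ (Ι (# 0) ⊕ Ι (# 1) ⊕ Ι (# 0) ⊗ Ι (# 1))

eval′-chromaticPolynomial-at-2 : ∀ s t → 2 ≤ s → 2 ≤ t →
  eval′ (chromaticPolynomial s t) (+ 2) ≡ + 2 * ((- + 1) ^ s + (- + 1) ^ t + (- + 1) ^ (s ℕ.+ t))
eval′-chromaticPolynomial-at-2 (suc zero) _ (s≤s ()) _
eval′-chromaticPolynomial-at-2 _ (suc zero) _ (s≤s ())
eval′-chromaticPolynomial-at-2 s@(suc (suc s′)) t@(suc (suc t′)) _ _ = begin
  eval′ (chromaticPolynomial s t) (+ 2)
    ≡⟨ eval′-toPoly (leaves s t) chromatic (+ 2) ⟩
  ⟦ ∂ chromatic ⟧ (values (leaves s t) (+ 2) ++ slopes (leaves s t) (+ 2))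
    ≡⟨ cong₂ (λ ρ ρ′ → ⟦ ∂ chromatic ⟧ (ρ ++ ρ′)) valuesAt2 slopesAt2 ⟩
  ⟦ ∂ chromatic ⟧ (+ 2 ∷ + 1 ∷ + 0 ∷ σ ∷ + 1 ∷ + 0 ∷ τ
                   ∷ + 1 ∷ slope 1 s ∷ + 0 ∷ slope 3 s ∷ slope 1 t ∷ + 0 ∷ slope 3 t ∷ [])
    ≡⟨ ∂chromatic-at-2 σ τ (slope 1 s) (slope 3 s) (slope 1 t) (slope 3 t) ⟩
  + 2 * (σ + τ + σ * τ)
    ≡⟨ cong (λ y → + 2 * (σ + τ + y)) (ℤP.^-distribˡ-+-* (- + 1) s t) ⟨
  + 2 * (σ + τ + (- + 1) ^ (s ℕ.+ t)) ∎
  where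
  open ≡-Reasoning
  open ChromaticForm using (chromatic)
  σ = (- + 1) ^ s
  τ = (- + 1) ^ t
  valuesAt2 : values (leaves s t) (+ 2) ≡ + 2 ∷ + 1 ∷ + 0 ∷ σ ∷ + 1 ∷ + 0 ∷ τ ∷ []
  valuesAt2 = cong₂ _∷_ refl
    (cong₂ _∷_ (trans (eval-leaf (+ 1) s (+ 2)) (ℤP.^-zeroˡ s))
    (cong₂ _∷_ (eval-leaf (+ 2) s (+ 2)) (cong₂ _∷_ (eval-leaf (+ 3) s (+ 2))
    (cong₂ _∷_ (trans (eval-leaf (+ 1) t (+ 2)) (ℤP.^-zeroˡ t))
    (cong₂ _∷_ (eval-leaf (+ 2) t (+ 2)) (cong₂ _∷_ (eval-leaf (+ 3) t (+ 2)) refl))))))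
  slope : ℕ → ℕ → ℤ
  slope a n = eval′ (linearFactor (+ a) ^ₚ n) (+ 2)
  root : eval (linearFactor (+ 2)) (+ 2) ≡ + 0
  root = refl
  slopesAt2 : slopes (leaves s t) (+ 2) ≡ + 1 ∷ slope 1 s ∷ + 0 ∷ slope 3 s ∷ slope 1 t ∷ + 0 ∷ slope 3 t ∷ []
  slopesAt2 = cong₂ _∷_ refl (cong₂ _∷_ refl (cong₂ _∷_ (eval′-^ₚ-doubleRoot (linearFactor (+ 2)) s′ (+ 2) root)
    (cong₂ _∷_ refl (cong₂ _∷_ refl (cong₂ _∷_ (eval′-^ₚ-doubleRoot (linearFactor (+ 2)) t′ (+ 2) root) refl)))))

-1^[2q]≡1 : ∀ q → (- + 1) ^ (q ℕ.* 2) ≡ + 1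
-1^[2q]≡1 zero    = refl
-1^[2q]≡1 (suc q) rewrite -1^[2q]≡1 q = refl

-1^odd≡-1 : ∀ n → n ℕ.% 2 ≡ 1 → (- + 1) ^ n ≡ - + 1
-1^odd≡-1 n n%2≡1 = begin
  (- + 1) ^ n
    ≡⟨ cong ((- + 1) ^_) (trans (m≡m%n+[m/n]*n n 2) (cong (ℕ._+ n ℕ./ 2 ℕ.* 2) n%2≡1)) ⟩
  - + 1 * (- + 1) ^ (n ℕ./ 2 ℕ.* 2)
    ≡⟨ cong (λ y → - + 1 * y) (-1^[2q]≡1 (n ℕ./ 2)) ⟩
  - + 1 ∎
  where open ≡-Reasoning

mainTheorem2 : (s t : ℕ) → 3 ≤ s → 3 ≤ t →
    Σ Poly (IsChromaticPolynomial (X s t))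
    × ((P : Poly) → IsChromaticPolynomial (X s t) P →
         (eval (deriv P) (+ 2)
            ≡ + 2 * (((- + 1) ^ s) + ((- + 1) ^ t) + ((- + 1) ^ (s ℕ.+ t))))
         × (s ℕ.% 2 ≡ 1 → t ℕ.% 2 ≡ 1 → eval (deriv P) (+ 2) ≡ - + 2))
mainTheorem2 s t 3≤s 3≤t = (P₀ , P₀-chromatic) , λ P P-chromatic →
  P′[2] P P-chromatic , λ s-odd t-odd → trans (P′[2] P P-chromatic) (cong (λ y → + 2 * y) (odd s-odd t-odd))
  where
  P₀ = chromaticPolynomial s t
  P₀-chromatic = chromaticPolynomial-isChromatic s t
  P′[2] : ∀ P → IsChromaticPolynomial (X s t) P →
    eval′ P (+ 2) ≡ + 2 * ((- + 1) ^ s + (- + 1) ^ t + (- + 1) ^ (s ℕ.+ t))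
  P′[2] P P-chromatic = trans
    (eval′-unique P P₀ (λ k → trans (P-chromatic k) (sym (P₀-chromatic k))) (+ 2))
    (eval′-chromaticPolynomial-at-2 s t (ℕP.≤-trans (ℕP.n≤1+n 2) 3≤s) (ℕP.≤-trans (ℕP.n≤1+n 2) 3≤t))
  odd : s ℕ.% 2 ≡ 1 → t ℕ.% 2 ≡ 1 → (- + 1) ^ s + (- + 1) ^ t + (- + 1) ^ (s ℕ.+ t) ≡ - + 1
  odd s-odd t-odd rewrite ℤP.^-distribˡ-+-* (- + 1) s t | -1^odd≡-1 s s-odd | -1^odd≡-1 t t-odd = refl
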